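{- Let $v\geq 8$ be even. If a symmetric configuration $v_3$ has no blocking set, then its Levi graph is not Hamiltonian.
   Context: A symmetric configuration $v_3$ is a finite incidence structure consisting of a set $V$ of $v$ points and a collection of $v$ blocks, each block a $3$-element subset of $V$, such that each point lies in exactly $3$ blocks and any two distinct points lie together in at most one block. Its Levi graph is the bipartite graph whose vertices are the points and blocks, a point being adjacent to each block containing it. A blocking set is a subset $Q\subseteq V$ such that every block contains at least one point of $Q$ and at least one point of $V\setminus Q$. -}

module Defs where

open import Data.Nat using (ℕ; suc; _+_; _∸_)
open import Data.Fin using (Fin; toℕ)
open import Data.Bool using (Bool; true; false)
open import Data.Sum using (_⊎_; inj₁; inj₂)
open import Data.Product using (Σ; ∃; _×_; _,_)
open import Data.Empty using (⊥)
open import Relation.Binary.PropositionalEquality using (_≡_; _≢_)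
open import Function.Definitions using (Injective; Surjective)
open import Relation.Nullary using (¬_)

-- A symmetric configuration v_3: points are Fin v, blocks are indexed by Fin v.
-- Block b consists of the three (pairwise distinct) points pts b 0, pts b 1, pts b 2.
record Configuration (v : ℕ) : Set where
  field
    pts : Fin v → Fin 3 → Fin v
    pts-inj : ∀ b → Injective _≡_ _≡_ (pts b)

  _∈B_ : Fin v → Fin v → Set
  p ∈B b = ∃ λ i → pts b i ≡ p

  field
    -- each point lies in exactly 3 blocks: the blocks containing p are
    -- exactly the images of an injective map Fin 3 → blocks
    degree3 : ∀ p → Σ (Fin 3 → Fin v) λ f →
                Injective _≡_ _≡_ f × (∀ b → (p ∈B b → ∃ λ j → f j ≡ b) × (∀ j → p ∈B f j))
    linear : ∀ p q b b' → p ≢ q → p ∈B b → q ∈B b → p ∈B b' → q ∈B b' → b ≡ b'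

open Configuration public

IsBlockingSet : ∀ {v} → Configuration v → (Fin v → Bool) → Set
IsBlockingSet C Q = ∀ b → (∃ λ i → Q (pts C b i) ≡ true) × (∃ λ j → Q (pts C b j) ≡ false)

HasBlockingSet : ∀ {v} → Configuration v → Set
HasBlockingSet C = ∃ λ Q → IsBlockingSet C Q

LeviAdj : ∀ {v} → Configuration v → Fin v ⊎ Fin v → Fin v ⊎ Fin v → Set
LeviAdj C (inj₁ p) (inj₁ q) = ⊥
LeviAdj C (inj₁ p) (inj₂ b) = _∈B_ C p b
LeviAdj C (inj₂ b) (inj₁ p) = _∈B_ C p b
LeviAdj C (inj₂ b) (inj₂ b') = ⊥

-- A Hamiltonian cycle in a graph with vertex type V having N vertices:
-- a bijective enumeration c : Fin N → V of all vertices such that consecutive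
-- vertices (cyclically, last to first) are adjacent.
IsHamiltonianCycle : ∀ {V : Set} (N : ℕ) → (V → V → Set) → (Fin N → V) → Set
IsHamiltonianCycle {V} N Adj c =
  Injective _≡_ _≡_ c × Surjective _≡_ _≡_ c ×
  (∀ i j → (toℕ j ≡ suc (toℕ i) ⊎ (toℕ i ≡ N ∸ 1 × toℕ j ≡ 0)) → Adj (c i) (c j))

IsHamiltonian : ∀ {V : Set} (N : ℕ) → (V → V → Set) → Set
IsHamiltonian {V} N Adj = ∃ λ (c : Fin N → V) → IsHamiltonianCycle N Adj c

LeviHamiltonian : ∀ {v} → Configuration v → Set
LeviHamiltonian {v} C = IsHamiltonian (v + v) (LeviAdj C)

-- Along a Hamiltonian cycle of the Levi graph, points and blocks alternate,
-- so the two points adjacent to a block on the cycle sit at positions two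
-- apart. Colour the positions in runs of two (false, false, true, true, ...):
-- positions two apart get opposite colours, and because the cycle has length
-- 2v ≡ 0 (mod 4) the colouring is consistent around the cycle. Colouring each
-- point by its position therefore gives every block points of both colours.
module Submission where

open import Defs
open import Data.Nat using (ℕ; zero; suc; _+_; _*_; _∸_; _≤_; _%_; _/_; NonZero)
open import Data.Nat.Properties using (+-comm; +-identityʳ; suc-injective; m≤n⇒m<n∨m≡n)
open import Data.Nat.DivMod using (m≡m%n+[m/n]*n; [m+kn]%n≡m%n; m<n⇒m%n≡m; n%n≡0; m∣n⇒o%n%m≡o%m)
open import Data.Nat.Divisibility using (_∣_; *-monoʳ-∣)
open import Data.Fin using (Fin; zero; suc; toℕ; fromℕ; fromℕ<; inject₁)
open import Data.Fin.Properties using (toℕ<n; toℕ-fromℕ; toℕ-fromℕ<; toℕ-inject₁)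
open import Data.Bool using (Bool; true; false; not)
open import Data.Bool.Properties using (not-involutive)
open import Data.Sum using (_⊎_; inj₁; inj₂)
open import Data.Product using (∃; _×_; _,_; proj₁; proj₂)
open import Function using (_∘_)
open import Relation.Nullary using (¬_)
open import Relation.Binary.PropositionalEquality using (_≡_; refl; sym; trans; cong; subst; module ≡-Reasoning)
open ≡-Reasoning

pairParity : ℕ → Bool
pairParity zero = false
pairParity (suc zero) = false
pairParity (suc (suc n)) = not (pairParity n)

pairParity-periodic : ∀ k m → pairParity (k * 4 + m) ≡ pairParity m
pairParity-periodic zero m = refl
pairParity-periodic (suc k) m = trans (not-involutive _) (pairParity-periodic k m)

pairParity-%4 : ∀ n → pairParity (n % 4) ≡ pairParity n
pairParity-%4 n = begin
  pairParity (n % 4)             ≡⟨ sym (pairParity-periodic (n / 4) (n % 4)) ⟩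
  pairParity (n / 4 * 4 + n % 4) ≡⟨ cong pairParity (+-comm (n / 4 * 4) (n % 4)) ⟩
  pairParity (n % 4 + n / 4 * 4) ≡⟨ cong pairParity (sym (m≡m%n+[m/n]*n n 4)) ⟩
  pairParity n                   ∎

pairParity-% : ∀ {N} .{{_ : NonZero N}} → 4 ∣ N → ∀ n → pairParity (n % N) ≡ pairParity n
pairParity-% {N} 4∣N n = begin
  pairParity (n % N)     ≡⟨ sym (pairParity-%4 (n % N)) ⟩
  pairParity (n % N % 4) ≡⟨ cong pairParity (m∣n⇒o%n%m≡o%m 4 N n 4∣N) ⟩
  pairParity (n % 4)     ≡⟨ pairParity-%4 n ⟩
  pairParity n           ∎

suc-% : ∀ m N .{{_ : NonZero N}} → suc (m % N) % N ≡ suc m % N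
suc-% m N = begin
  suc (m % N) % N               ≡⟨ sym ([m+kn]%n≡m%n (suc (m % N)) (m / N) N) ⟩
  suc (m % N + m / N * N) % N   ≡⟨ cong (λ x → suc x % N) (sym (m≡m%n+[m/n]*n m N)) ⟩
  suc m % N                     ∎

CyclicSucc : ∀ {N} → Fin N → Fin N → Set
CyclicSucc {N} i j = toℕ j ≡ suc (toℕ i) ⊎ (toℕ i ≡ N ∸ 1 × toℕ j ≡ 0)

cyclicSucc-exists : ∀ {N} (i : Fin N) → ∃ (CyclicSucc i)
cyclicSucc-exists {suc n} i with m≤n⇒m<n∨m≡n (toℕ<n i)
... | inj₁ 1+i<N = fromℕ< 1+i<N , inj₁ (toℕ-fromℕ< 1+i<N)
... | inj₂ 1+i≡N = zero , inj₂ (suc-injective 1+i≡N , refl)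

cyclicPred-exists : ∀ {N} (j : Fin N) → ∃ λ i → CyclicSucc i j
cyclicPred-exists {suc n} zero = fromℕ n , inj₂ (toℕ-fromℕ n , refl)
cyclicPred-exists (suc j) = inject₁ j , inj₁ (cong suc (sym (toℕ-inject₁ j)))

toℕ-cyclicSucc : ∀ {n} {i j : Fin (suc n)} → CyclicSucc i j → toℕ j ≡ suc (toℕ i) % suc n
toℕ-cyclicSucc {n} {i} {j} (inj₁ j≡1+i) = begin
  toℕ j                 ≡⟨ sym (m<n⇒m%n≡m (toℕ<n j)) ⟩
  toℕ j % suc n         ≡⟨ cong (_% suc n) j≡1+i ⟩
  suc (toℕ i) % suc n   ∎
toℕ-cyclicSucc {n} {i} {j} (inj₂ (i≡n , j≡0)) = begin
  toℕ j                 ≡⟨ j≡0 ⟩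
  0                     ≡⟨ sym (n%n≡0 (suc n)) ⟩
  suc n % suc n         ≡⟨ cong (λ m → suc m % suc n) (sym i≡n) ⟩
  suc (toℕ i) % suc n   ∎

pairParity-twoSteps : ∀ {N} → 4 ∣ N → {i k j : Fin N} → CyclicSucc i k → CyclicSucc k j →
  pairParity (toℕ j) ≡ not (pairParity (toℕ i))
pairParity-twoSteps {suc n} 4∣N {i} {k} {j} i→k k→j = begin
  pairParity (toℕ j)                             ≡⟨ cong pairParity (toℕ-cyclicSucc k→j) ⟩
  pairParity (suc (toℕ k) % suc n)               ≡⟨ cong (λ m → pairParity (suc m % suc n)) (toℕ-cyclicSucc i→k) ⟩
  pairParity (suc (suc (toℕ i) % suc n) % suc n) ≡⟨ cong pairParity (suc-% (suc (toℕ i)) (suc n)) ⟩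
  pairParity (suc (suc (toℕ i)) % suc n)         ≡⟨ pairParity-% 4∣N (suc (suc (toℕ i))) ⟩
  not (pairParity (toℕ i))                       ∎

takes-both-values : ∀ {A : Set} (f : A → Bool) {x y} → f x ≡ not (f y) →
  (∃ λ a → f a ≡ true) × (∃ λ a → f a ≡ false)
takes-both-values f {x} {y} fx≡¬fy with f y in fy≡
... | true = (y , fy≡) , (x , fx≡¬fy)
... | false = (x , fx≡¬fy) , (y , fy≡)

module _ {v} (C : Configuration v) where

  LeviAdj-sym : ∀ x y → LeviAdj C x y → LeviAdj C y x
  LeviAdj-sym (inj₁ p) (inj₂ b) p∈b = p∈b
  LeviAdj-sym (inj₂ b) (inj₁ p) p∈b = p∈b

  blockNeighbour : ∀ {b} y → LeviAdj C (inj₂ b) y → ∃ λ p → y ≡ inj₁ p × _∈B_ C p b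
  blockNeighbour (inj₁ p) p∈b = p , refl , p∈b

  blockingSet-of-hamiltonian : 4 ∣ v + v → LeviHamiltonian C → HasBlockingSet C
  blockingSet-of-hamiltonian 4∣2v (c , c-inj , c-surj , c-adj) = colour , bichromatic
    where
    position : Fin v ⊎ Fin v → Fin (v + v)
    position x = proj₁ (c-surj x)

    c-position : ∀ x → c (position x) ≡ x
    c-position x = proj₂ (c-surj x) refl

    colour : Fin v → Bool
    colour p = pairParity (toℕ (position (inj₁ p)))

    neighbourColour : ∀ b l → LeviAdj C (c (position (inj₂ b))) (c l) →
      ∃ λ x → colour (pts C b x) ≡ pairParity (toℕ l)
    neighbourColour b l adj
      with blockNeighbour (c l) (subst (λ z → LeviAdj C z (c l)) (c-position (inj₂ b)) adj)
    ... | p , cl≡p , x , bx≡p =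
      x , trans (cong colour bx≡p) (cong (pairParity ∘ toℕ) (c-inj (trans (c-position (inj₁ p)) (sym cl≡p))))

    bichromatic : IsBlockingSet C colour
    bichromatic b =
      let k = position (inj₂ b)
          (i , i→k) = cyclicPred-exists k
          (j , k→j) = cyclicSucc-exists k
          (x , x-colour) = neighbourColour b j (c-adj k j k→j)
          (y , y-colour) = neighbourColour b i (LeviAdj-sym (c i) (c k) (c-adj i k i→k))
      in takes-both-values (colour ∘ pts C b) {x} {y} (begin
        colour (pts C b x)         ≡⟨ x-colour ⟩
        pairParity (toℕ j)         ≡⟨ pairParity-twoSteps 4∣2v i→k k→j ⟩
        not (pairParity (toℕ i))   ≡⟨ cong not (sym y-colour) ⟩
        not (colour (pts C b y))   ∎)

lemma16 : (v : ℕ) → 8 ≤ v → 2 ∣ v → (C : Configuration v) →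
    ¬ HasBlockingSet C → ¬ LeviHamiltonian C
lemma16 v _ 2∣v C noBlockingSet =
  noBlockingSet ∘ blockingSet-of-hamiltonian C 4∣v+v
  where
  4∣v+v : 4 ∣ v + v
  4∣v+v = subst (4 ∣_) (cong (v +_) (+-identityʳ v)) (*-monoʳ-∣ 2 2∣v)
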